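{- A formula $\phi$ is valid (i.e., belongs to Gödel–Löb logic $\mathsf{GL}$) iff the linear nested sequent $\vdash \phi$ is provable in $\mathsf{LNGL}$.
   Context: Formulae are built from atoms by $\neg,\lor,\Box$; validity is truth at all worlds of all Kripke models with transitive, conversely wellfounded accessibility relation. A linear nested sequent is $\Gamma_{1} \vdash \Delta_{1} \mathbin{/\!/} \cdots \mathbin{/\!/} \Gamma_{n} \vdash \Delta_{n}$ with formula multisets $\Gamma_i,\Delta_i$. The calculus $\mathsf{LNGL}$ has rules ($\mathcal{G}$ a possibly empty prefix): $\mathsf{id_1}$: $\mathcal{G} \mathbin{/\!/} \Gamma, p \vdash p, \Delta$; $\mathsf{id_2}$: $\mathcal{G} \mathbin{/\!/} \Gamma, \Box\phi \vdash \Box\phi, \Delta$; $\lor\mathsf{L}$: from $\mathcal{G} \mathbin{/\!/} \Gamma, \phi \vdash \Delta$ and $\mathcal{G} \mathbin{/\!/} \Gamma, \psi \vdash \Delta$ infer $\mathcal{G} \mathbin{/\!/} \Gamma, \phi\lor\psi \vdash \Delta$; $\lor\mathsf{R}$: from $\mathcal{G} \mathbin{/\!/} \Gamma \vdash \phi,\psi,\Delta$ infer $\mathcal{G} \mathbin{/\!/} \Gamma \vdash \phi\lor\psi,\Delta$; $\neg\mathsf{L}$: from $\mathcal{G} \mathbin{/\!/} \Gamma \vdash \phi,\Delta$ infer $\mathcal{G} \mathbin{/\!/} \Gamma,\neg\phi \vdash \Delta$; $\neg\mathsf{R}$: from $\mathcal{G} \mathbin{/\!/} \Gamma,\phi \vdash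 \Delta$ infer $\mathcal{G} \mathbin{/\!/} \Gamma \vdash \neg\phi,\Delta$; $\mathsf{4L}$: from $\mathcal{G} \mathbin{/\!/} \Gamma,\Box\phi \vdash \Delta \mathbin{/\!/} \Sigma,\Box\phi \vdash \Pi$ infer $\mathcal{G} \mathbin{/\!/} \Gamma,\Box\phi \vdash \Delta \mathbin{/\!/} \Sigma \vdash \Pi$; $\Box\mathsf{L}$: from $\mathcal{G} \mathbin{/\!/} \Gamma,\Box\phi \vdash \Delta \mathbin{/\!/} \Sigma,\phi \vdash \Pi$ infer $\mathcal{G} \mathbin{/\!/} \Gamma,\Box\phi \vdash \Delta \mathbin{/\!/} \Sigma \vdash \Pi$; $\Box\mathsf{R}$: from $\mathcal{G} \mathbin{/\!/} \Gamma \vdash \Delta \mathbin{/\!/} \Box\phi \vdash \phi$ infer $\mathcal{G} \mathbin{/\!/} \Gamma \vdash \Box\phi,\Delta$. -}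

module Defs where

open import Data.Nat using (ℕ)
open import Data.List using (List; []; _∷_; [_]; _++_)
open import Data.List.Relation.Binary.Permutation.Propositional using (_↭_)
open import Data.Product using (_×_; _,_)
open import Data.Sum using (_⊎_)
open import Data.Empty using (⊥)
open import Function using (flip)
open import Relation.Binary.Definitions using (Transitive)
open import Induction.WellFounded using (WellFounded)

data Fml : Set where
  var  : ℕ → Fml
  neg  : Fml → Fml
  _or_ : Fml → Fml → Fml
  box  : Fml → Fml

record GLModel : Set₁ where
  field
    W     : Set
    R     : W → W → Set
    V     : ℕ → W → Set
    trans : Transitive R
    cwf   : WellFounded (flip R)

open GLModel public

_,_⊨_ : (M : GLModel) → W M → Fml → Set
M , w ⊨ var p    = V M p w
M , w ⊨ neg φ    = M , w ⊨ φ → ⊥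
M , w ⊨ (φ or ψ) = (M , w ⊨ φ) ⊎ (M , w ⊨ ψ)
M , w ⊨ box φ    = ∀ v → R M w v → M , v ⊨ φ

Valid : Fml → Set₁
Valid φ = ∀ (M : GLModel) (w : W M) → M , w ⊨ φ

-- Linear nested sequents  Γ₁ ⊢ Δ₁ // ⋯ // Γₙ ⊢ Δₙ
-- A component is a pair (Γ , Δ) of lists read as multisets (every rule's
-- conclusion is matched up to permutation _↭_ of the relevant multiset).
-- A linear nested sequent is a list of components, leftmost first.

Comp : Set
Comp = List Fml × List Fml

LNS : Set
LNS = List Comp

data LNGL : LNS → Set where
  id₁ : ∀ {G Γ Δ Γ₀ Δ₀ p} → Γ ↭ (var p ∷ Γ₀) → Δ ↭ (var p ∷ Δ₀) →
        LNGL (G ++ [ (Γ , Δ) ])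
  id₂ : ∀ {G Γ Δ Γ₀ Δ₀ φ} → Γ ↭ (box φ ∷ Γ₀) → Δ ↭ (box φ ∷ Δ₀) →
        LNGL (G ++ [ (Γ , Δ) ])
  orL : ∀ {G Γ Δ Γ₀ φ ψ} → Γ ↭ ((φ or ψ) ∷ Γ₀) →
        LNGL (G ++ [ (φ ∷ Γ₀ , Δ) ]) →
        LNGL (G ++ [ (ψ ∷ Γ₀ , Δ) ]) →
        LNGL (G ++ [ (Γ , Δ) ])
  orR : ∀ {G Γ Δ Δ₀ φ ψ} → Δ ↭ ((φ or ψ) ∷ Δ₀) →
        LNGL (G ++ [ (Γ , φ ∷ ψ ∷ Δ₀) ]) →
        LNGL (G ++ [ (Γ , Δ) ])
  negL : ∀ {G Γ Δ Γ₀ φ} → Γ ↭ (neg φ ∷ Γ₀) →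
         LNGL (G ++ [ (Γ₀ , φ ∷ Δ) ]) →
         LNGL (G ++ [ (Γ , Δ) ])
  negR : ∀ {G Γ Δ Δ₀ φ} → Δ ↭ (neg φ ∷ Δ₀) →
         LNGL (G ++ [ (φ ∷ Γ , Δ₀) ]) →
         LNGL (G ++ [ (Γ , Δ) ])
  4L : ∀ {G Γ Δ Γ₀ Σ Π φ} → Γ ↭ (box φ ∷ Γ₀) →
       LNGL (G ++ (Γ , Δ) ∷ (box φ ∷ Σ , Π) ∷ []) →
       LNGL (G ++ (Γ , Δ) ∷ (Σ , Π) ∷ [])
  boxL : ∀ {G Γ Δ Γ₀ Σ Π φ} → Γ ↭ (box φ ∷ Γ₀) →
         LNGL (G ++ (Γ , Δ) ∷ (φ ∷ Σ , Π) ∷ []) →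
         LNGL (G ++ (Γ , Δ) ∷ (Σ , Π) ∷ [])
  boxR : ∀ {G Γ Δ Δ₀ φ} → Δ ↭ (box φ ∷ Δ₀) →
         LNGL (G ++ (Γ , Δ₀) ∷ (box φ ∷ [] , φ ∷ []) ∷ []) →
         LNGL (G ++ [ (Γ , Δ) ])

⊢_ : Fml → LNS
⊢ φ = [ ([] , φ ∷ []) ]

module Submission where

-- Soundness: a refutation of c₁ // ⋯ // cₙ is an R-chain of worlds refuting the components in
-- order, and every rule turns a refutation of its conclusion into one of a premise; for □R one
-- picks, by converse wellfoundedness, an R-maximal successor refuting φ, which then forces □φ.
-- Completeness: an underivable sequent is first saturated by the invertible propositional rules.
-- Each □ψ on the right of the saturated last component Γ ⊢ Δ then yields, by □R followed by 4L
-- and □L, an underivable successor component  χ, □χ (for every □χ ∈ Γ), □ψ ⊢ ψ.  The rooted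
-- countermodels of these successors, placed under a common root satisfying exactly the atoms of Γ,
-- refute Γ ⊢ Δ. The recursion terminates because each successor has on its left a boxed
-- subformula of the end-sequent that its parent lacks.

open import Defs
open import Level using (0ℓ)
open import Axiom.ExcludedMiddle using (ExcludedMiddle)
open import Axiom.DoubleNegationElimination using (em⇒dne)
open import Function.Base using (_∘_; flip; id)
open import Function.Bundles using (_⇔_; mk⇔; Equivalence)
open import Function.Related.TypeIsomorphisms using (¬-cong-⇔)
open import Data.Sum.Function.Propositional using (_⊎-⇔_)
open import Data.Empty using (⊥; ⊥-elim)
open import Data.Unit using (⊤; tt)
open import Data.Product using (∃; ∃₂; _×_; _,_; proj₁; proj₂)
open import Data.Sum using (_⊎_; inj₁; inj₂; [_,_]′)
open import Data.Nat using (ℕ; suc; _+_; _≤_; _<_; z≤n; s≤s)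
open import Data.Nat.Properties
  using (≤-reflexive; ≤-trans; +-identityʳ; +-monoʳ-≤; +-monoˡ-<; m≤n+m; m≤n⇒m≤1+n; m<n⇒m<1+n; module ≤-Reasoning)
open import Data.Nat.ListAction using (sum)
open import Data.Nat.ListAction.Properties using (sum-++; sum-↭)
open import Data.Nat.Induction using (<-wellFounded)
open import Data.List using (List; []; _∷_; [_]; _++_; map; foldl; filter; length; concatMap)
open import Data.List.Properties using (∷ʳ-injective; ++-assoc; foldl-∷ʳ; map-++)
open import Data.List.Membership.Propositional using (_∈_; find)
open import Data.List.Membership.Propositional.Properties using (∈-∃++; ∈-++⁺ˡ; ∈-++⁺ʳ)
open import Data.List.Relation.Unary.Any using (here; there)
open import Data.List.Relation.Unary.All as All using (All; []; _∷_; all?)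
open import Data.List.Relation.Unary.All.Properties as All using (¬All⇒Any¬)
open import Data.List.Relation.Binary.Permutation.Propositional using (_↭_; ↭-sym; ↭-refl; ↭-trans)
open import Data.List.Relation.Binary.Permutation.Propositional.Properties
  using (All-resp-↭; ∈-resp-↭; shift; shifts; ++⁺ˡ; ++⁺ʳ; map⁺)
open import Relation.Nullary using (¬_; yes; no)
open import Relation.Unary using (Decidable)
open import Relation.Binary.PropositionalEquality as ≡ using (_≡_; _≢_; refl; sym; cong; subst)
open import Relation.Binary.Definitions using (Transitive)
open import Induction.WellFounded using (Acc; acc; WellFounded)

open Equivalence using (to; from)

∈⇒↭ : ∀ {A : Set} {x : A} {xs} → x ∈ xs → ∃ λ ys → xs ↭ x ∷ ys
∈⇒↭ x∈xs with ys , zs , refl ← ∈-∃++ x∈xs = ys ++ zs , shift _ ys zs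

module _ {A : Set} {P Q : A → Set} (P? : Decidable P) (Q? : Decidable Q) (P⇒Q : ∀ {x} → P x → Q x) where

  filter-length-≤ : ∀ xs → length (filter P? xs) ≤ length (filter Q? xs)
  filter-length-≤ [] = z≤n
  filter-length-≤ (x ∷ xs) with P? x | Q? x
  ... | yes _  | yes _  = s≤s (filter-length-≤ xs)
  ... | yes px | no ¬qx = ⊥-elim (¬qx (P⇒Q px))
  ... | no _   | yes _  = m≤n⇒m≤1+n (filter-length-≤ xs)
  ... | no _   | no _   = filter-length-≤ xs

  filter-length-< : ∀ {x xs} → x ∈ xs → Q x → ¬ P x → length (filter P? xs) < length (filter Q? xs)
  filter-length-< {xs = y ∷ xs} (here refl) qy ¬py with P? y | Q? y
  ... | yes py | _      = ⊥-elim (¬py py)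
  ... | no _   | yes _  = s≤s (filter-length-≤ xs)
  ... | no _   | no ¬qy = ⊥-elim (¬qy qy)
  filter-length-< {xs = y ∷ xs} (there x∈xs) qx ¬px with P? y | Q? y
  ... | yes _  | yes _  = s≤s (filter-length-< x∈xs qx ¬px)
  ... | yes py | no ¬qy = ⊥-elim (¬qy (P⇒Q py))
  ... | no _   | yes _  = m<n⇒m<1+n (filter-length-< x∈xs qx ¬px)
  ... | no _   | no _   = filter-length-< x∈xs qx ¬px

Refutes : (M : GLModel) → W M → Comp → Set
Refutes M w (Γ , Δ) = All (M , w ⊨_) Γ × All (λ ψ → ¬ M , w ⊨ ψ) Δ

Extend : (M : GLModel) → (W M → Set) → Comp → W M → Set
Extend M P c w = ∃ λ v → P v × Refutes M v c × R M v w

-- Before M G w: the components of G are refuted, in order, along an R-chain whose last world sees w.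
Before : (M : GLModel) → LNS → W M → Set
Before M = foldl (Extend M) (λ _ → ⊤)

before-∷ʳ : ∀ M G c {w} → Before M (G ++ [ c ]) w ≡ Extend M (Before M G) c w
before-∷ʳ M G c {w} = cong (λ P → P w) (foldl-∷ʳ (Extend M) _ c G)

refutes-shared : ∀ {M w Γ Δ Γ₀ Δ₀ x} → Γ ↭ x ∷ Γ₀ → Δ ↭ x ∷ Δ₀ → ¬ Refutes M w (Γ , Δ)
refutes-shared pΓ pΔ (t , f) with tx ∷ _ ← All-resp-↭ pΓ t | ¬tx ∷ _ ← All-resp-↭ pΔ f = ¬tx tx

module _ (em : ExcludedMiddle 0ℓ) where

  private
    dne = em⇒dne em

  maximal-refuter : ∀ M (P : W M → Set) {w v} → Acc (flip (R M)) v → R M w v → ¬ P v →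
                    ∃ λ u → R M w u × ¬ P u × (∀ y → R M u y → P y)
  maximal-refuter M P {v = v} (acc rs) wRv ¬Pv with em {∃ λ y → R M v y × ¬ P y}
  ... | yes (y , vRy , ¬Py) = maximal-refuter M P (rs vRy) (trans M wRv vRy) ¬Py
  ... | no none = v , wRv , ¬Pv , λ y vRy → dne λ ¬Py → none (y , vRy , ¬Py)

  löb-witness : ∀ M {w} a → ¬ M , w ⊨ box a → ∃ λ v → R M w v × ¬ M , v ⊨ a × M , v ⊨ box a
  löb-witness M a ¬□a =
    let v , wRv , ¬a = dne λ none → ¬□a λ v wRv → dne λ ¬a → none (v , wRv , ¬a)
    in maximal-refuter M (M ,_⊨ a) (cwf M v) wRv ¬a

  -- The index is an equation because G ++ [ c ] does not unify with the conclusions of the rules.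
  sound : ∀ M {S G c w} → LNGL S → S ≡ G ++ [ c ] → Before M G w → Refutes M w c → ⊥
  sound M (id₁ {G₀} pΓ pΔ) eq _ ref with refl , refl ← ∷ʳ-injective G₀ _ eq = refutes-shared pΓ pΔ ref
  sound M (id₂ {G₀} pΓ pΔ) eq _ ref with refl , refl ← ∷ʳ-injective G₀ _ eq = refutes-shared pΓ pΔ ref
  sound M (orL {G₀} pΓ d₁ d₂) eq before (t , f) with refl , refl ← ∷ʳ-injective G₀ _ eq
    with All-resp-↭ pΓ t
  ... | inj₁ a ∷ t₀ = sound M d₁ refl before (a ∷ t₀ , f)
  ... | inj₂ b ∷ t₀ = sound M d₂ refl before (b ∷ t₀ , f)
  sound M (orR {G₀} pΔ d) eq before (t , f) with refl , refl ← ∷ʳ-injective G₀ _ eq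
    with ¬a∨b ∷ f₀ ← All-resp-↭ pΔ f = sound M d refl before (t , ¬a∨b ∘ inj₁ ∷ ¬a∨b ∘ inj₂ ∷ f₀)
  sound M (negL {G₀} pΓ d) eq before (t , f) with refl , refl ← ∷ʳ-injective G₀ _ eq
    with ¬a ∷ t₀ ← All-resp-↭ pΓ t = sound M d refl before (t₀ , ¬a ∷ f)
  sound M (negR {G₀} pΔ d) eq before (t , f) with refl , refl ← ∷ʳ-injective G₀ _ eq
    with ¬¬a ∷ f₀ ← All-resp-↭ pΔ f = sound M d refl before (dne ¬¬a ∷ t , f₀)
  sound M (4L {G₀} {Γ} {Δ} pΓ d) eq before (t , f)
    with refl , refl ← ∷ʳ-injective (G₀ ++ [ (Γ , Δ) ]) _ (≡.trans (++-assoc G₀ _ _) eq)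
    with _ , _ , (tv , _) , vRw ← subst id (before-∷ʳ M G₀ _) before
    with □a ∷ _ ← All-resp-↭ pΓ tv
    = sound M d (sym (++-assoc G₀ _ _)) before ((λ u wRu → □a u (trans M vRw wRu)) ∷ t , f)
  sound M (boxL {G₀} {Γ} {Δ} pΓ d) eq before (t , f)
    with refl , refl ← ∷ʳ-injective (G₀ ++ [ (Γ , Δ) ]) _ (≡.trans (++-assoc G₀ _ _) eq)
    with _ , _ , (tv , _) , vRw ← subst id (before-∷ʳ M G₀ _) before
    with □a ∷ _ ← All-resp-↭ pΓ tv
    = sound M d (sym (++-assoc G₀ _ _)) before (□a _ vRw ∷ t , f)
  sound M (boxR {G₀} {φ = a} pΔ d) eq before (t , f) with refl , refl ← ∷ʳ-injective G₀ _ eq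
    with ¬□a ∷ f₀ ← All-resp-↭ pΔ f
    with v , wRv , ¬a , □a ← löb-witness M a ¬□a
    = sound M d (sym (++-assoc G₀ _ _))
        (subst id (sym (before-∷ʳ M G₀ _)) (_ , before , (t , f₀) , wRv))
        (□a ∷ [] , ¬a ∷ [])

  soundness : ∀ φ → LNGL (⊢ φ) → Valid φ
  soundness φ ⊢φ M w = dne λ ¬φ → sound M {G = []} ⊢φ refl tt ([] , ¬φ ∷ [])

record BoundedMorphism (M N : GLModel) : Set where
  field
    fun   : W M → W N
    val   : ∀ {p w} → V M p w ⇔ V N p (fun w)
    forth : ∀ {w v} → R M w v → R N (fun w) (fun v)
    back  : ∀ {w u} → R N (fun w) u → ∃ λ v → R M w v × fun v ≡ u

module _ {M N : GLModel} (h : BoundedMorphism M N) where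
  open BoundedMorphism h

  ⊨-invariant : ∀ φ {w} → (M , w ⊨ φ) ⇔ (N , fun w ⊨ φ)
  ⊨-invariant (var p) = val
  ⊨-invariant (neg φ) = ¬-cong-⇔ (⊨-invariant φ)
  ⊨-invariant (φ or ψ) = ⊨-invariant φ ⊎-⇔ ⊨-invariant ψ
  ⊨-invariant (box φ) {w} = mk⇔ forward backward
    where
    forward : M , w ⊨ box φ → N , fun w ⊨ box φ
    forward □φ u wRu with v , wRv , refl ← back wRu = to (⊨-invariant φ) (□φ v wRv)
    backward : N , fun w ⊨ box φ → M , w ⊨ box φ
    backward □φ v wRv = from (⊨-invariant φ) (□φ (fun v) (forth wRv))

module Cone {I : Set} (M : I → GLModel) (V₀ : ℕ → Set) where

  data World : Set where
    apex : World
    at   : (i : I) → W (M i) → World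

  data _≺_ : World → World → Set where
    apex≺  : ∀ {i x} → apex ≺ at i x
    inside : ∀ {i x y} → R (M i) x y → at i x ≺ at i y

  ≺-trans : Transitive _≺_
  ≺-trans apex≺ (inside _) = apex≺
  ≺-trans (inside r) (inside r′) = inside (trans (M _) r r′)

  acc-at : ∀ {i x} → Acc (flip (R (M i))) x → Acc (flip _≺_) (at i x)
  acc-at (acc rs) = acc λ { (inside r) → acc-at (rs r) }

  ≺-cwf : WellFounded (flip _≺_)
  ≺-cwf apex = acc λ { (apex≺ {i} {x}) → acc-at (cwf (M i) x) }
  ≺-cwf (at i x) = acc-at (cwf (M i) x)

  valuation : ℕ → World → Set
  valuation p apex = V₀ p
  valuation p (at i x) = V (M i) p x

  cone : GLModel
  cone = record { W = World ; R = _≺_ ; V = valuation ; trans = ≺-trans ; cwf = ≺-cwf }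

  at-morphism : ∀ i → BoundedMorphism (M i) cone
  at-morphism i = record
    { fun = at i ; val = mk⇔ id id ; forth = inside ; back = λ { (inside r) → _ , r , refl } }

data _≼_ : Fml → Fml → Set where
  ≼-refl : ∀ {a} → a ≼ a
  ≼-neg  : ∀ {x a} → x ≼ a → x ≼ neg a
  ≼-orˡ  : ∀ {x a b} → x ≼ a → x ≼ (a or b)
  ≼-orʳ  : ∀ {x a b} → x ≼ b → x ≼ (a or b)
  ≼-box  : ∀ {x a} → x ≼ a → x ≼ box a

≼-trans : ∀ {x y z} → x ≼ y → y ≼ z → x ≼ z
≼-trans p ≼-refl = p
≼-trans p (≼-neg q) = ≼-neg (≼-trans p q)
≼-trans p (≼-orˡ q) = ≼-orˡ (≼-trans p q)
≼-trans p (≼-orʳ q) = ≼-orʳ (≼-trans p q)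
≼-trans p (≼-box q) = ≼-box (≼-trans p q)

subformulas : Fml → List Fml
properSubformulas : Fml → List Fml
subformulas a = a ∷ properSubformulas a
properSubformulas (var _) = []
properSubformulas (neg a) = subformulas a
properSubformulas (a or b) = subformulas a ++ subformulas b
properSubformulas (box a) = subformulas a

≼⇒∈ : ∀ {x a} → x ≼ a → x ∈ subformulas a
≼⇒∈ ≼-refl = here refl
≼⇒∈ (≼-neg p) = there (≼⇒∈ p)
≼⇒∈ (≼-orˡ p) = there (∈-++⁺ˡ (≼⇒∈ p))
≼⇒∈ (≼-orʳ {a = a} p) = there (∈-++⁺ʳ (subformulas a) (≼⇒∈ p))
≼⇒∈ (≼-box p) = there (≼⇒∈ p)

formulas : Comp → List Fml
formulas (Γ , Δ) = Γ ++ Δ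

Within : Fml → Comp → Set
Within φ c = All (_≼ φ) (formulas c)

data VarOrBox : Fml → Set where
  isVar : ∀ {p} → VarOrBox (var p)
  isBox : ∀ {a} → VarOrBox (box a)

varOrBox? : Decidable VarOrBox
varOrBox? (var _) = yes isVar
varOrBox? (neg _) = no λ ()
varOrBox? (_ or _) = no λ ()
varOrBox? (box _) = yes isBox

Saturated : Comp → Set
Saturated (Γ , Δ) = All VarOrBox Γ × All VarOrBox Δ

non-varOrBox : ∀ {L} → ¬ All VarOrBox L → ∃₂ λ x L₀ → L ↭ x ∷ L₀ × ¬ VarOrBox x
non-varOrBox {L} ¬all with x , x∈L , ¬vb ← find (¬All⇒Any¬ varOrBox? L ¬all) = x , _ , proj₂ (∈⇒↭ x∈L) , ¬vb

weight : Fml → ℕ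
weight (var _) = 0
weight (neg a) = suc (weight a)
weight (a or b) = suc (weight a + weight b)
weight (box _) = 0

weights : List Fml → ℕ
weights = sum ∘ map weight

weights-↭ : ∀ {L L′} → L ↭ L′ → weights L ≡ weights L′
weights-↭ p = sum-↭ (map⁺ weight p)

weights-++ : ∀ L L′ → weights (L ++ L′) ≡ weights L + weights L′
weights-++ L L′ = ≡.trans (cong sum (map-++ weight L L′)) (sum-++ (map weight L) (map weight L′))

-- ys ⊏ x: a propositional rule with principal formula x puts ys in its place.
infix 4 _⊏_

data _⊏_ : List Fml → Fml → Set where
  neg⊏ : ∀ {a} → [ a ] ⊏ neg a
  orˡ⊏ : ∀ {a b} → [ a ] ⊏ (a or b)
  orʳ⊏ : ∀ {a b} → [ b ] ⊏ (a or b)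
  or⊏  : ∀ {a b} → a ∷ b ∷ [] ⊏ (a or b)

⊏-lighter : ∀ {ys x} → ys ⊏ x → weights ys < weight x
⊏-lighter neg⊏ = s≤s (≤-reflexive (+-identityʳ _))
⊏-lighter (orˡ⊏ {a}) = s≤s (+-monoʳ-≤ (weight a) z≤n)
⊏-lighter (orʳ⊏ {a} {b}) = s≤s (≤-trans (≤-reflexive (+-identityʳ _)) (m≤n+m (weight b) (weight a)))
⊏-lighter (or⊏ {a}) = s≤s (≤-reflexive (cong (weight a +_) (+-identityʳ _)))

⊏-subformulas : ∀ {ys x} → ys ⊏ x → All (_≼ x) ys
⊏-subformulas neg⊏ = ≼-neg ≼-refl ∷ []
⊏-subformulas orˡ⊏ = ≼-orˡ ≼-refl ∷ []
⊏-subformulas orʳ⊏ = ≼-orʳ ≼-refl ∷ []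
⊏-subformulas or⊏ = ≼-orˡ ≼-refl ∷ ≼-orʳ ≼-refl ∷ []

data Unfolds (L L′ : List Fml) : Set where
  unfold : ∀ {x ys rest} → L ↭ x ∷ rest → L′ ↭ ys ++ rest → ys ⊏ x → Unfolds L L′

unfolds-lighter : ∀ {L L′} → Unfolds L L′ → weights L′ < weights L
unfolds-lighter {L} {L′} (unfold {x} {ys} {rest} p q ys⊏x) = begin-strict
  weights L′                 ≡⟨ weights-↭ q ⟩
  weights (ys ++ rest)       ≡⟨ weights-++ ys rest ⟩
  weights ys + weights rest  <⟨ +-monoˡ-< (weights rest) (⊏-lighter ys⊏x) ⟩
  weight x + weights rest    ≡⟨ sym (weights-↭ p) ⟩
  weights L                  ∎
  where open ≤-Reasoning

unfolds-within : ∀ {φ L L′} → Unfolds L L′ → All (_≼ φ) L → All (_≼ φ) L′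
unfolds-within (unfold p q ys⊏x) L≼φ with x≼φ ∷ rest≼φ ← All-resp-↭ p L≼φ =
  All-resp-↭ (↭-sym q) (All.++⁺ (All.map (λ y≼x → ≼-trans y≼x x≼φ) (⊏-subformulas ys⊏x)) rest≼φ)

infix 4 _⊆□_ _⇝_

_⊆□_ : List Fml → List Fml → Set
Γ ⊆□ Γ′ = ∀ {χ} → box χ ∈ Γ → box χ ∈ Γ′

drop-nonbox : ∀ {Γ x Γ₀} → Γ ↭ x ∷ Γ₀ → (∀ {χ} → x ≢ box χ) → Γ ⊆□ Γ₀
drop-nonbox p x≢□ χ∈Γ with ∈-resp-↭ p χ∈Γ
... | here eq = ⊥-elim (x≢□ (sym eq))
... | there χ∈Γ₀ = χ∈Γ₀

record _⇝_ (c c′ : Comp) : Set₁ where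
  field
    boxes-kept : proj₁ c ⊆□ proj₁ c′
    within     : ∀ {φ} → Within φ c → Within φ c′
    reflects   : ∀ M {w} → Refutes M w c′ → Refutes M w c

open _⇝_

⇝-refl : ∀ {c} → c ⇝ c
⇝-refl = record { boxes-kept = id ; within = id ; reflects = λ _ → id }

⇝-trans : ∀ {c c′ c″} → c ⇝ c′ → c′ ⇝ c″ → c ⇝ c″
⇝-trans s t = record
  { boxes-kept = boxes-kept t ∘ boxes-kept s
  ; within = within t ∘ within s
  ; reflects = λ M → reflects s M ∘ reflects t M
  }

weightᶜ : Comp → ℕ
weightᶜ = weights ∘ formulas

Step : Comp → Comp → Set₁
Step c c′ = c ⇝ c′ × weightᶜ c′ < weightᶜ c

unfolding-step : ∀ {Γ Δ Γ′ Δ′} → Unfolds (Γ ++ Δ) (Γ′ ++ Δ′) → Γ ⊆□ Γ′ →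
                 (∀ M {w} → Refutes M w (Γ′ , Δ′) → Refutes M w (Γ , Δ)) → Step (Γ , Δ) (Γ′ , Δ′)
unfolding-step u kept reflect =
  record { boxes-kept = kept ; within = unfolds-within u ; reflects = reflect } , unfolds-lighter u

record RootedCountermodel (c : Comp) : Set₁ where
  field
    model   : GLModel
    root    : W model
    rooted  : ∀ v → v ≡ root ⊎ R model root v
    refutes : Refutes model root c

reflect : ∀ {c c′} → c ⇝ c′ → RootedCountermodel c′ → RootedCountermodel c
reflect c⇝c′ m = record { RootedCountermodel m ; refutes = reflects c⇝c′ model refutes }
  where open RootedCountermodel m

-- What a component passes on to its successor through 4L and □L.
heir : Fml → List Fml
heir (box a) = a ∷ box a ∷ []
heir _ = []

inherit : List Fml → List Fml
inherit = concatMap heir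

inherit-unboxed : ∀ {Γ χ} → box χ ∈ Γ → χ ∈ inherit Γ
inherit-unboxed (here refl) = here refl
inherit-unboxed {x ∷ _} (there χ∈Γ) = ∈-++⁺ʳ (heir x) (inherit-unboxed χ∈Γ)

inherit-boxes : ∀ {Γ} → Γ ⊆□ inherit Γ
inherit-boxes (here refl) = there (here refl)
inherit-boxes {x ∷ _} (there χ∈Γ) = ∈-++⁺ʳ (heir x) (inherit-boxes χ∈Γ)

heir-within : ∀ {φ} x → x ≼ φ → All (_≼ φ) (heir x)
heir-within (var _) _ = []
heir-within (neg _) _ = []
heir-within (_ or _) _ = []
heir-within (box _) □a≼φ = ≼-trans (≼-box ≼-refl) □a≼φ ∷ □a≼φ ∷ []

inherit-within : ∀ {φ Γ} → All (_≼ φ) Γ → All (_≼ φ) (inherit Γ)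
inherit-within [] = []
inherit-within (x≼φ ∷ Γ≼φ) = All.++⁺ (heir-within _ x≼φ) (inherit-within Γ≼φ)

inheritL : ∀ {G Γ Δ Σ Π} L → L ⊆□ Γ →
           LNGL (G ++ (Γ , Δ) ∷ (inherit L ++ Σ , Π) ∷ []) → LNGL (G ++ (Γ , Δ) ∷ (Σ , Π) ∷ [])
inheritL [] _ d = d
inheritL {G} (box a ∷ L) L⊆Γ d with _ , p ← ∈⇒↭ (L⊆Γ (here refl)) =
  inheritL L (L⊆Γ ∘ there) (4L {G = G} p (boxL {G = G} p d))
inheritL (var _ ∷ L) L⊆Γ d = inheritL L (L⊆Γ ∘ there) d
inheritL (neg _ ∷ L) L⊆Γ d = inheritL L (L⊆Γ ∘ there) d
inheritL ((_ or _) ∷ L) L⊆Γ d = inheritL L (L⊆Γ ∘ there) d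

boxR-inherit : ∀ {G Γ Δ Δ₀ ψ} → Δ ↭ box ψ ∷ Δ₀ →
               LNGL ((G ++ [ (Γ , Δ₀) ]) ++ [ (inherit Γ ++ [ box ψ ] , [ ψ ]) ]) → LNGL (G ++ [ (Γ , Δ) ])
boxR-inherit {G} {Γ} p d = boxR p (inheritL Γ id (subst LNGL (++-assoc G _ _) d))

record Witness (Γ : List Fml) (ψ : Fml) : Set₁ where
  field
    model   : GLModel
    world   : W model
    refutes : ¬ model , world ⊨ ψ
    boxed   : ∀ {χ} → box χ ∈ Γ → ∀ v → model , v ⊨ χ

rooted-witness : ∀ {Γ ψ} → RootedCountermodel (inherit Γ ++ [ box ψ ] , [ ψ ]) → Witness Γ ψ
rooted-witness {Γ} m with t , ¬ψ ∷ [] ← RootedCountermodel.refutes m =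
  record { model = model ; world = root ; refutes = ¬ψ ; boxed = boxed }
  where
  open RootedCountermodel m using (model; root; rooted)
  boxed : ∀ {χ} → box χ ∈ Γ → ∀ v → model , v ⊨ χ
  boxed χ∈Γ v with rooted v
  ... | inj₁ refl = All.lookup t (∈-++⁺ˡ (inherit-unboxed χ∈Γ))
  ... | inj₂ rRv = All.lookup t (∈-++⁺ˡ (inherit-boxes χ∈Γ)) v rRv

cone-countermodel : ∀ {Γ Δ} → Saturated (Γ , Δ) → (∀ {p} → var p ∈ Δ → ¬ var p ∈ Γ) →
                    (∀ {ψ} → box ψ ∈ Δ → Witness Γ ψ) → RootedCountermodel (Γ , Δ)
cone-countermodel {Γ} {Δ} (satΓ , satΔ) atoms witness = record
  { model = cone ; root = apex ; rooted = rooted ; refutes = All.tabulate true , All.tabulate false }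
  where
  child : (∃ λ ψ → box ψ ∈ Δ) → GLModel
  child (_ , ψ∈Δ) = Witness.model (witness ψ∈Δ)
  open Cone child (λ p → var p ∈ Γ)
  rooted : ∀ v → v ≡ apex ⊎ apex ≺ v
  rooted apex = inj₁ refl
  rooted (at _ _) = inj₂ apex≺
  true : ∀ {x} → x ∈ Γ → cone , apex ⊨ x
  true x∈Γ with All.lookup satΓ x∈Γ
  ... | isVar = x∈Γ
  ... | isBox {χ} = λ { apex () ; (at i y) apex≺ →
                        to (⊨-invariant (at-morphism i) χ) (Witness.boxed (witness (proj₂ i)) x∈Γ y) }
  false : ∀ {x} → x ∈ Δ → ¬ cone , apex ⊨ x
  false x∈Δ with All.lookup satΔ x∈Δ
  ... | isVar = atoms x∈Δ
  ... | isBox {ψ} = λ □ψ →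
    Witness.refutes (witness x∈Δ) (from (⊨-invariant (at-morphism (ψ , x∈Δ)) ψ) (□ψ _ apex≺))

module _ (em : ExcludedMiddle 0ℓ) where

  Progress : LNS → Comp → Set₁
  Progress G c = ∃ λ c′ → Step c c′ × ¬ LNGL (G ++ [ c′ ])

  progressL : ∀ {G Γ Δ x Γ₀} → Γ ↭ x ∷ Γ₀ → ¬ VarOrBox x → ¬ LNGL (G ++ [ (Γ , Δ) ]) → Progress G (Γ , Δ)
  progressL {x = var _} _ ¬vb _ = ⊥-elim (¬vb isVar)
  progressL {x = box _} _ ¬vb _ = ⊥-elim (¬vb isBox)
  progressL {Δ = Δ} {neg a} {Γ₀} p _ ⊬ =
    (Γ₀ , a ∷ Δ) ,
    unfolding-step (unfold (++⁺ʳ Δ p) (shift a Γ₀ Δ) neg⊏) (drop-nonbox p λ ())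
      (λ { M (t₀ , ¬a ∷ f) → All-resp-↭ (↭-sym p) (¬a ∷ t₀) , f }) ,
    ⊬ ∘ negL p
  -- Some premise of ∨L is underivable; excluded middle tells which.
  progressL {G} {Δ = Δ} {a or b} {Γ₀} p _ ⊬ with em {LNGL (G ++ [ (a ∷ Γ₀ , Δ) ])}
  ... | no ⊬a =
    (a ∷ Γ₀ , Δ) ,
    unfolding-step (unfold (++⁺ʳ Δ p) ↭-refl orˡ⊏) (there ∘ drop-nonbox p λ ())
      (λ { M (ta ∷ t₀ , f) → All-resp-↭ (↭-sym p) (inj₁ ta ∷ t₀) , f }) ,
    ⊬a
  ... | yes ⊢a =
    (b ∷ Γ₀ , Δ) ,
    unfolding-step (unfold (++⁺ʳ Δ p) ↭-refl orʳ⊏) (there ∘ drop-nonbox p λ ())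
      (λ { M (tb ∷ t₀ , f) → All-resp-↭ (↭-sym p) (inj₂ tb ∷ t₀) , f }) ,
    ⊬ ∘ orL p ⊢a

  progressR : ∀ {G Γ Δ x Δ₀} → Δ ↭ x ∷ Δ₀ → ¬ VarOrBox x → ¬ LNGL (G ++ [ (Γ , Δ) ]) → Progress G (Γ , Δ)
  progressR {x = var _} _ ¬vb _ = ⊥-elim (¬vb isVar)
  progressR {x = box _} _ ¬vb _ = ⊥-elim (¬vb isBox)
  progressR {Γ = Γ} {x = neg a} {Δ₀} p _ ⊬ =
    (a ∷ Γ , Δ₀) ,
    unfolding-step (unfold (↭-trans (++⁺ˡ Γ p) (shift _ Γ Δ₀)) ↭-refl neg⊏) there
      (λ { M (ta ∷ t , f₀) → t , All-resp-↭ (↭-sym p) ((λ ¬a → ¬a ta) ∷ f₀) }) ,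
    ⊬ ∘ negR p
  progressR {Γ = Γ} {x = a or b} {Δ₀} p _ ⊬ =
    (Γ , a ∷ b ∷ Δ₀) ,
    unfolding-step (unfold (↭-trans (++⁺ˡ Γ p) (shift _ Γ Δ₀)) (shifts Γ (a ∷ b ∷ [])) or⊏) id
      (λ { M (t , ¬a ∷ ¬b ∷ f₀) → t , All-resp-↭ (↭-sym p) ([ ¬a , ¬b ]′ ∷ f₀) }) ,
    ⊬ ∘ orR p

  saturated-or-progress : ∀ {G} c → ¬ LNGL (G ++ [ c ]) → Saturated c ⊎ Progress G c
  saturated-or-progress (Γ , Δ) ⊬ with all? varOrBox? Γ | all? varOrBox? Δ
  ... | yes satΓ | yes satΔ = inj₁ (satΓ , satΔ)
  ... | no ¬satΓ | _ = let _ , _ , p , ¬vb = non-varOrBox ¬satΓ in inj₂ (progressL p ¬vb ⊬)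
  ... | yes _ | no ¬satΔ = let _ , _ , p , ¬vb = non-varOrBox ¬satΔ in inj₂ (progressR p ¬vb ⊬)

  saturate : ∀ {G} c → Acc _<_ (weightᶜ c) → ¬ LNGL (G ++ [ c ]) →
             ∃ λ c′ → c ⇝ c′ × Saturated c′ × ¬ LNGL (G ++ [ c′ ])
  saturate c (acc rs) ⊬ with saturated-or-progress c ⊬
  ... | inj₁ sat = c , ⇝-refl , sat , ⊬
  ... | inj₂ (c₁ , (c⇝c₁ , lighter) , ⊬₁) with c′ , c₁⇝c′ , sat , ⊬′ ← saturate c₁ (rs lighter) ⊬₁ =
    c′ , ⇝-trans c⇝c₁ c₁⇝c′ , sat , ⊬′

  module _ (φ : Fml) where

    MissingBox : List Fml → Fml → Set
    MissingBox Γ x = ∃ λ χ → x ≡ box χ × ¬ box χ ∈ Γ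

    missingBox? : ∀ Γ → Decidable (MissingBox Γ)
    missingBox? Γ x = em

    -- Each successor component gains a missing box, so this decreases along the construction.
    budget : List Fml → ℕ
    budget Γ = length (filter (missingBox? Γ) (subformulas φ))

    budget-< : ∀ {Γ Γ′ ψ} → Γ ⊆□ Γ′ → box ψ ≼ φ → ¬ box ψ ∈ Γ → box ψ ∈ Γ′ → budget Γ′ < budget Γ
    budget-< {Γ} {Γ′} Γ⊆Γ′ ψ≼φ ψ∉Γ ψ∈Γ′ =
      filter-length-< (missingBox? Γ′) (missingBox? Γ) (λ { (χ , refl , χ∉Γ′) → χ , refl , χ∉Γ′ ∘ Γ⊆Γ′ })
        (≼⇒∈ ψ≼φ) (_ , refl , ψ∉Γ) (λ { (_ , refl , ψ∉Γ′) → ψ∉Γ′ ψ∈Γ′ })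

    countermodel : ∀ {G} c → Saturated c → Within φ c → ¬ LNGL (G ++ [ c ]) →
                   Acc _<_ (budget (proj₁ c)) → RootedCountermodel c
    countermodel {G} (Γ , Δ) sat c≼φ ⊬ (acc rs) = cone-countermodel sat atoms witness
      where
      atoms : ∀ {p} → var p ∈ Δ → ¬ var p ∈ Γ
      atoms p∈Δ p∈Γ = ⊬ (id₁ (proj₂ (∈⇒↭ p∈Γ)) (proj₂ (∈⇒↭ p∈Δ)))

      successor : Fml → Comp
      successor ψ = inherit Γ ++ [ box ψ ] , [ ψ ]

      successor-within : ∀ {ψ} → box ψ ≼ φ → Within φ (successor ψ)
      successor-within □ψ≼φ =
        All.++⁺ (All.++⁺ (inherit-within (All.++⁻ˡ Γ c≼φ)) (□ψ≼φ ∷ [])) (≼-trans (≼-box ≼-refl) □ψ≼φ ∷ [])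

      witness : ∀ {ψ} → box ψ ∈ Δ → Witness Γ ψ
      witness {ψ} □ψ∈Δ
        with Δ₀ , p ← ∈⇒↭ □ψ∈Δ
        with c′ , s⇝c′ , sat′ , ⊬′ ← saturate (successor ψ) (<-wellFounded _) (⊬ ∘ boxR-inherit p)
        = rooted-witness (reflect s⇝c′
            (countermodel c′ sat′ (within s⇝c′ (successor-within □ψ≼φ)) ⊬′ (rs smaller)))
        where
        □ψ≼φ : box ψ ≼ φ
        □ψ≼φ = All.lookup (All.++⁻ʳ Γ c≼φ) □ψ∈Δ
        smaller : budget (proj₁ c′) < budget Γ
        smaller = budget-< (boxes-kept s⇝c′ ∘ ∈-++⁺ˡ ∘ inherit-boxes) □ψ≼φ
                    (λ □ψ∈Γ → ⊬ (id₂ (proj₂ (∈⇒↭ □ψ∈Γ)) p))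
                    (boxes-kept s⇝c′ (∈-++⁺ʳ (inherit Γ) (here refl)))

    completeness : Valid φ → LNGL (⊢ φ)
    completeness valid = em⇒dne em λ ⊬φ →
      let c , start⇝c , sat , ⊬c = saturate {G = []} ([] , [ φ ]) (<-wellFounded _) ⊬φ
          m = reflect start⇝c
                (countermodel {G = []} c sat (within start⇝c (≼-refl ∷ [])) ⊬c (<-wellFounded _))
          open RootedCountermodel m
      in All.head (proj₂ refutes) (valid model root)

corollary4p8 : ExcludedMiddle 0ℓ → (φ : Fml) → Valid φ ⇔ LNGL (⊢ φ)
corollary4p8 em φ = mk⇔ (completeness em φ) (soundness em φ)
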